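{- For any ditree $T$, $\rho(T)=\gamma(T)$.
   Context: All digraphs are finite, and their arc relation is irreflexive (no loops); both arcs $uv$ and $vu$ may be present. For a digraph $D$ and vertex $v$, $N^+_D(v)$ is the set of out-neighbors of $v$ (vertices $w$ with $vw$ an arc), $N^+_D[v]=N^+_D(v)\cup\{v\}$, $N^-_D(v)$ is the set of in-neighbors of $v$, and $N^-_D[v]=N^-_D(v)\cup\{v\}$. The underlying graph of $D$ is the undirected graph on $V(D)$ in which $u,v$ are adjacent iff at least one of the arcs $uv$, $vu$ is in $D$. A ditree is a digraph whose underlying graph is a tree. A set $S\subseteq V(D)$ is dominating if $\bigcup_{v\in S}N^+_D[v]=V(D)$; $\gamma(D)$ is the minimum size of a dominating set. A set $P\subseteq V(D)$ is a packing if $N^-_D[x]\cap N^-_D[y]=\emptyset$ for all distinct $x,y\in P$; $\rho(D)$ is the maximum size of a packing. -}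

module Defs where

open import Data.Nat using (ℕ; _≤_; _≥_)
open import Data.Fin using (Fin)
open import Data.Fin.Subset using (Subset; _∈_; ∣_∣)
open import Data.List using (List; _∷_; []; _++_; length)
open import Data.List.Relation.Unary.Linked using (Linked)
open import Data.List.Relation.Unary.Unique.Propositional using (Unique)
open import Data.Product using (Σ; _×_; ∃)
open import Data.Sum using (_⊎_)
open import Relation.Binary.PropositionalEquality using (_≡_; _≢_)
open import Relation.Nullary using (¬_)

record Digraph (n : ℕ) : Set₁ where
  field
    Arc    : Fin n → Fin n → Set
    irrefl : ∀ v → ¬ Arc v v

module _ {n : ℕ} (D : Digraph n) where
  open Digraph D

  InClosedOut : Fin n → Fin n → Set
  InClosedOut v w = w ≡ v ⊎ Arc v w

  InClosedIn : Fin n → Fin n → Set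
  InClosedIn x z = z ≡ x ⊎ Arc z x

  Adj : Fin n → Fin n → Set
  Adj u v = Arc u v ⊎ Arc v u

  data Walk : Fin n → Fin n → Set where
    here  : ∀ {v} → Walk v v
    step  : ∀ {u v w} → Adj u v → Walk v w → Walk u w

  Connected : Set
  Connected = ∀ u v → Walk u v

  record Cycle : Set where
    field
      x y    : Fin n
      ms     : List (Fin n)
      long   : 1 ≤ length ms
      linked : Linked Adj (x ∷ ms ++ (y ∷ []))
      closes : Adj y x
      unique : Unique (x ∷ ms ++ (y ∷ []))

  Acyclic : Set
  Acyclic = ¬ Cycle

  IsDitree : Set
  IsDitree = Connected × Acyclic

  Dominating : Subset n → Set
  Dominating S = ∀ w → ∃ λ v → v ∈ S × InClosedOut v w

  Packing : Subset n → Set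
  Packing P = ∀ x y → x ∈ P → y ∈ P → x ≢ y →
              ∀ z → ¬ (InClosedIn x z × InClosedIn y z)

  IsDominationNumber : ℕ → Set
  IsDominationNumber k =
    (Σ (Subset n) λ S → Dominating S × ∣ S ∣ ≡ k) ×
    (∀ S → Dominating S → k ≤ ∣ S ∣)

  IsPackingNumber : ℕ → Set
  IsPackingNumber k =
    (Σ (Subset n) λ P → Packing P × ∣ P ∣ ≡ k) ×
    (∀ P → Packing P → ∣ P ∣ ≤ k)

module Submission where

-- ρ ≤ γ holds in every digraph: sending each vertex of a packing to a vertex that dominates it
-- is injective, because two packing vertices never share a closed in-neighbour.
--
-- For γ ≤ ρ, grow a subtree of the underlying tree from a root one vertex at a time, recording
-- depths d. Any two vertices of the subtree are joined by a simple path inside it, so a new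
-- vertex has only one neighbour in the subtree (a second one would close a cycle). Hence every
-- vertex has at most one neighbour, its parent, that is not deeper than itself. Now repeatedly
-- take a deepest vertex x that is not yet dominated, add x to the packing, and dominate with
-- the parent of x if it is an in-neighbour of x, and with x itself otherwise. This dominator
-- dominates every vertex y no deeper than x with N⁻[x] ∩ N⁻[y] ≠ ∅, which is exactly what keeps
-- the chosen vertices a packing. Each step adds one packing vertex and at most one dominating one.

open import Defs
open import Data.Nat using (ℕ; zero; suc; _≤_; _<_; z≤n; s≤s; _≤?_)
open import Data.Nat.Properties
  using (≤-refl; ≤-trans; ≤-antisym; <⇒≤; <⇒≱; ≰⇒>; n≤1+n; n<1+n; ≤-totalOrder; module ≤-Reasoning)
open import Data.Fin using (Fin; zero; suc; _≟_)
open import Data.Fin.Properties using (any?; ¬Fin0)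
open import Data.Fin.Subset
open import Data.Fin.Subset.Properties
open import Data.Fin.Subset.Induction using (⊂-wellFounded; ⊃-wellFounded)
open import Data.Vec.Base using (_∷_; here; there; tabulate)
open import Data.Vec.Properties using (lookup⇒[]=; []=⇒lookup; lookup∘tabulate)
open import Data.Vec.Functional using (updateAt)
open import Data.Vec.Functional.Properties using (updateAt-updates; updateAt-minimal)
open import Data.Empty using (⊥-elim)
open import Data.Sum using (_⊎_; inj₁; inj₂)
open import Data.Product using (∃; ∃₂; _×_; _,_; proj₁; proj₂)
open import Data.List using (List; []; _∷_; _++_; [_]; _∷ʳ_; filter; allFin)
open import Data.List.Extrema ≤-totalOrder using (argmax; argmax-all; f[xs]≤f[argmax])
open import Data.List.Relation.Unary.All as All using (All; []; _∷_)
open import Data.List.Relation.Unary.All.Properties using (∷ʳ⁺; all-filter)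
open import Data.List.Relation.Unary.AllPairs using ([]; _∷_)
open import Data.List.Relation.Unary.Linked using (Linked; [-]; _∷_)
open import Data.List.Relation.Unary.Unique.Propositional using (Unique)
open import Data.List.Membership.Propositional.Properties using (∈-filter⁺; ∈-allFin)
open import Function using (_∘_)
open import Induction.WellFounded using (Acc; acc)
open import Relation.Binary.PropositionalEquality
  using (_≡_; _≢_; refl; sym; trans; subst; subst₂; ≢-sym)
open import Relation.Nullary using (¬_; Dec; yes; no; does)
open import Relation.Nullary.Decidable
  using (_×-dec_; _⊎-dec_; ¬?; dec-true; decidable-stable; ¬¬-excluded-middle)
open import Relation.Nullary.Negation using (¬¬-map)

x∈p─q⇒x∉q : ∀ {n} {p q : Subset n} {x} → x ∈ p ─ q → x ∉ q
x∈p─q⇒x∉q {p = _ ∷ _} {inside ∷ _} {zero}  ()         here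
x∈p─q⇒x∉q {p = _ ∷ _} {_ ∷ _}      {suc _} (there x∈) (there x∈q) = x∈p─q⇒x∉q x∈ x∈q

x∈p∪⁅y⁆⁻ : ∀ {n} {p : Subset n} {x y} → x ∈ p ∪ ⁅ y ⁆ → x ∈ p ⊎ x ≡ y
x∈p∪⁅y⁆⁻ {p = p} {y = y} x∈ with x∈p∪q⁻ p ⁅ y ⁆ x∈
... | inj₁ x∈p = inj₁ x∈p
... | inj₂ x∈y = inj₂ (x∈⁅y⁆⇒x≡y y x∈y)

y∈p∪⁅y⁆ : ∀ {n} {p : Subset n} {y} → y ∈ p ∪ ⁅ y ⁆
y∈p∪⁅y⁆ {y = y} = x∈p∪q⁺ (inj₂ (x∈⁅x⁆ y))

p⊆p∪⁅y⁆ : ∀ {n} {p : Subset n} {y} → p ⊆ p ∪ ⁅ y ⁆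
p⊆p∪⁅y⁆ x∈p = x∈p∪q⁺ (inj₁ x∈p)

p⊂p∪⁅x⁆ : ∀ {n} {p : Subset n} {x} → x ∉ p → p ⊂ p ∪ ⁅ x ⁆
p⊂p∪⁅x⁆ {x = x} x∉p = p⊆p∪⁅y⁆ , x , y∈p∪⁅y⁆ , x∉p

p⊆p-x∪⁅x⁆ : ∀ {n} (p : Subset n) x → p ⊆ (p - x) ∪ ⁅ x ⁆
p⊆p-x∪⁅x⁆ p x {y} y∈p with y ≟ x
... | yes refl = y∈p∪⁅y⁆
... | no  y≢x  = p⊆p∪⁅y⁆ (x∈p∧x≢y⇒x∈p-y y∈p y≢x)

∣p∪⁅x⁆∣≤1+∣p∣ : ∀ {n} (p : Subset n) x → ∣ p ∪ ⁅ x ⁆ ∣ ≤ suc ∣ p ∣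
∣p∪⁅x⁆∣≤1+∣p∣ (inside  ∷ p) zero    rewrite ∪-identityʳ p = n≤1+n _
∣p∪⁅x⁆∣≤1+∣p∣ (outside ∷ p) zero    rewrite ∪-identityʳ p = ≤-refl
∣p∪⁅x⁆∣≤1+∣p∣ (inside  ∷ p) (suc x) = s≤s (∣p∪⁅x⁆∣≤1+∣p∣ p x)
∣p∪⁅x⁆∣≤1+∣p∣ (outside ∷ p) (suc x) = ∣p∪⁅x⁆∣≤1+∣p∣ p x

injectiveOn⇒∣p∣≤∣q∣ : ∀ {n} {p q : Subset n} (f : Fin n → Fin n) →
  (∀ {x} → x ∈ p → f x ∈ q) → (∀ {x y} → x ∈ p → y ∈ p → f x ≡ f y → x ≡ y) →
  ∣ p ∣ ≤ ∣ q ∣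
injectiveOn⇒∣p∣≤∣q∣ {n} f = go (⊂-wellFounded _)
  where
  go : ∀ {p q} → Acc _⊂_ p → (∀ {x} → x ∈ p → f x ∈ q) →
       (∀ {x y} → x ∈ p → y ∈ p → f x ≡ f y → x ≡ y) → ∣ p ∣ ≤ ∣ q ∣
  go {p} {q} (acc rec) maps-to injective with nonempty? p
  ... | no  p-empty rewrite Empty-unique p-empty | ∣⊥∣≡0 n = z≤n
  ... | yes (x , x∈p) = begin
    ∣ p ∣                 ≤⟨ p⊆q⇒∣p∣≤∣q∣ (p⊆p-x∪⁅x⁆ p x) ⟩
    ∣ (p - x) ∪ ⁅ x ⁆ ∣   ≤⟨ ∣p∪⁅x⁆∣≤1+∣p∣ (p - x) x ⟩
    suc ∣ p - x ∣         ≤⟨ s≤s (go (rec (x∈p⇒p-x⊂p x∈p)) maps-to′ injective′) ⟩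
    suc ∣ q - f x ∣       ≤⟨ x∈p⇒∣p-x∣<∣p∣ (maps-to x∈p) ⟩
    ∣ q ∣                 ∎
    where
    open ≤-Reasoning
    p-x⊆p : p - x ⊆ p
    p-x⊆p = p─q⊆p p ⁅ x ⁆
    maps-to′ : ∀ {y} → y ∈ p - x → f y ∈ q - f x
    maps-to′ y∈ = x∈p∧x≢y⇒x∈p-y (maps-to (p-x⊆p y∈)) λ fy≡fx →
      x∈p─q⇒x∉q y∈ (subst (_∈ ⁅ x ⁆) (sym (injective (p-x⊆p y∈) x∈p fy≡fx)) (x∈⁅x⁆ x))
    injective′ : ∀ {y z} → y ∈ p - x → z ∈ p - x → f y ≡ f z → y ≡ z
    injective′ y∈ z∈ = injective (p-x⊆p y∈) (p-x⊆p z∈)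

select : ∀ {n} {Q : Fin n → Set} → (∀ x → Dec (Q x)) → Subset n
select Q? = tabulate (does ∘ Q?)

module _ {n} {Q : Fin n → Set} (Q? : ∀ x → Dec (Q x)) where

  ∈-select⁺ : ∀ {x} → Q x → x ∈ select Q?
  ∈-select⁺ {x} q = lookup⇒[]= x _ (trans (lookup∘tabulate _ x) (dec-true (Q? x) q))

  ∈-select⁻ : ∀ {x} → x ∈ select Q? → Q x
  ∈-select⁻ {x} x∈ with Q? x | trans (sym (lookup∘tabulate (does ∘ Q?) x)) ([]=⇒lookup x∈)
  ... | yes q | _ = q
  ... | no  _ | ()

deepest : ∀ {n} (d : Fin n → ℕ) {F : Subset n} → Nonempty F →
          ∃ λ x → x ∈ F × (∀ {y} → y ∈ F → d y ≤ d x)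
deepest {n} d {F} (x₀ , x₀∈F) =
  argmax d x₀ members , argmax-all d x₀∈F (all-filter (_∈? F) (allFin n)) , below
  where
  members : List (Fin n)
  members = filter (_∈? F) (allFin n)
  below : ∀ {y} → y ∈ F → d y ≤ d (argmax d x₀ members)
  below y∈F = All.lookup (f[xs]≤f[argmax] x₀ members) (∈-filter⁺ (_∈? F) (∈-allFin _) y∈F)

Linked-∷ʳ : ∀ {A : Set} {R : A → A → Set} {xs y z} →
            Linked R (xs ∷ʳ y) → R y z → Linked R (xs ∷ʳ y ∷ʳ z)
Linked-∷ʳ {xs = []}          [-]      ryz = ryz ∷ [-]
Linked-∷ʳ {xs = _ ∷ []}      (r ∷ rs) ryz = r ∷ Linked-∷ʳ {xs = []} rs ryz
Linked-∷ʳ {xs = _ ∷ x ∷ xs}  (r ∷ rs) ryz = r ∷ Linked-∷ʳ {xs = x ∷ xs} rs ryz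

Unique-∷ʳ : ∀ {A : Set} {xs : List A} {z} → Unique xs → All (z ≢_) xs → Unique (xs ∷ʳ z)
Unique-∷ʳ []            []            = [] ∷ []
Unique-∷ʳ (x∉xs ∷ uxs)  (z≢x ∷ z∉xs)  = ∷ʳ⁺ x∉xs (≢-sym z≢x) ∷ Unique-∷ʳ uxs z∉xs

¬¬-∀-Fin : ∀ {n} {P : Fin n → Set} → (∀ i → ¬ ¬ P i) → ¬ ¬ (∀ i → P i)
¬¬-∀-Fin {zero}  _ k = k λ ()
¬¬-∀-Fin {suc n} h k =
  h zero λ p₀ → ¬¬-∀-Fin (h ∘ suc) λ ps → k λ { zero → p₀ ; (suc i) → ps i }

module _ {n} (D : Digraph n) where
  open Digraph D

  Adj-sym : ∀ {u v} → Adj D u v → Adj D v u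
  Adj-sym (inj₁ uv) = inj₂ uv
  Adj-sym (inj₂ vu) = inj₁ vu

  Adj-irrefl : ∀ {u v} → Adj D u v → u ≢ v
  Adj-irrefl (inj₁ uv) refl = irrefl _ uv
  Adj-irrefl (inj₂ vu) refl = irrefl _ vu

  out⇒in : ∀ {v w} → InClosedOut D v w → InClosedIn D w v
  out⇒in (inj₁ refl) = inj₁ refl
  out⇒in (inj₂ vw)   = inj₂ vw

  ∣packing∣≤∣dominating∣ : ∀ {P S} → Packing D P → Dominating D S → ∣ P ∣ ≤ ∣ S ∣
  ∣packing∣≤∣dominating∣ {P} packing dominating =
    injectiveOn⇒∣p∣≤∣q∣ dominator (λ {x} _ → proj₁ (proj₂ (dominating x))) injective
    where
    dominator : Fin n → Fin n
    dominator x = proj₁ (dominating x)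
    dominator-in : ∀ x → InClosedIn D x (dominator x)
    dominator-in x = out⇒in (proj₂ (proj₂ (dominating x)))
    injective : ∀ {x y} → x ∈ P → y ∈ P → dominator x ≡ dominator y → x ≡ y
    injective {x} {y} x∈P y∈P same with x ≟ y
    ... | yes x≡y = x≡y
    ... | no  x≢y = ⊥-elim (packing x y x∈P y∈P x≢y (dominator x)
                              (dominator-in x , subst (InClosedIn D y) (sym same) (dominator-in y)))

  -- A simple path from a to b inside R, as a vertex list in the shape used by Cycle (so a ≢ b).
  record Path (R : Subset n) (a b : Fin n) : Set where
    field
      inner  : List (Fin n)
      linked : Linked (Adj D) (a ∷ inner ++ [ b ])
      unique : Unique (a ∷ inner ++ [ b ])
      within : All (_∈ R) (a ∷ inner ++ [ b ])

  module _ {R : Subset n} where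

    ∉⇒All≢ : ∀ {w xs} → w ∉ R → All (_∈ R) xs → All (w ≢_) xs
    ∉⇒All≢ w∉R = All.map λ x∈R w≡x → w∉R (subst (_∈ R) (sym w≡x) x∈R)

    edge : ∀ {a b} → a ∈ R → b ∈ R → Adj D a b → Path R a b
    edge a∈R b∈R ab = record
      { inner  = []
      ; linked = ab ∷ [-]
      ; unique = (Adj-irrefl ab ∷ []) ∷ [] ∷ []
      ; within = a∈R ∷ b∈R ∷ []
      }

    Path-weaken : ∀ {R′ a b} → R ⊆ R′ → Path R a b → Path R′ a b
    Path-weaken R⊆R′ π = record { Path π ; within = All.map R⊆R′ (Path.within π) }

    Path-∷ : ∀ {w a b} → w ∉ R → Adj D w a → Path R a b → Path (R ∪ ⁅ w ⁆) w b
    Path-∷ {a = a} w∉R wa π = record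
      { inner  = a ∷ inner
      ; linked = wa ∷ linked
      ; unique = ∉⇒All≢ w∉R within ∷ unique
      ; within = y∈p∪⁅y⁆ ∷ All.map p⊆p∪⁅y⁆ within
      }
      where open Path π

    Path-∷ʳ : ∀ {w a b} → w ∉ R → Adj D b w → Path R a b → Path (R ∪ ⁅ w ⁆) a w
    Path-∷ʳ {b = b} w∉R bw π = record
      { inner  = inner ∷ʳ b
      ; linked = Linked-∷ʳ {xs = _ ∷ inner} linked bw
      ; unique = Unique-∷ʳ unique (∉⇒All≢ w∉R within)
      ; within = ∷ʳ⁺ (All.map p⊆p∪⁅y⁆ within) y∈p∪⁅y⁆
      }
      where open Path π

    Path-close : ∀ {w u u′} → w ∉ R → Adj D w u → Adj D w u′ → Path R u u′ → Cycle D
    Path-close {w} {u} {u′} w∉R wu wu′ π = record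
      { x      = w
      ; y      = u′
      ; ms     = u ∷ inner
      ; long   = s≤s z≤n
      ; linked = wu ∷ linked
      ; closes = Adj-sym wu′
      ; unique = ∉⇒All≢ w∉R within ∷ unique
      }
      where open Path π

  -- Read d as depth below a root: the neighbour of u that is not deeper than u is its parent.
  AtMostOneParentOn : Subset n → (Fin n → ℕ) → Set
  AtMostOneParentOn R d = ∀ {u v v′} → u ∈ R → v ∈ R → v′ ∈ R →
    Adj D u v → Adj D u v′ → d v ≤ d u → d v′ ≤ d u → v ≡ v′

  AtMostOneParent : (Fin n → ℕ) → Set
  AtMostOneParent d = ∀ {u v v′} → Adj D u v → Adj D u v′ → d v ≤ d u → d v′ ≤ d u → v ≡ v′

  record Grown (R : Subset n) (d : Fin n → ℕ) : Set where
    field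
      nonempty : Nonempty R
      parent   : AtMostOneParentOn R d
      path     : ∀ {a b} → a ∈ R → b ∈ R → a ≢ b → Path R a b

  Grown-⁅_⁆ : ∀ r → Grown ⁅ r ⁆ (λ _ → 0)
  Grown-⁅ r ⁆ = record
    { nonempty = r , x∈⁅x⁆ r
    ; parent   = λ _ v∈ v′∈ _ _ _ _ → trans (x∈⁅y⁆⇒x≡y r v∈) (sym (x∈⁅y⁆⇒x≡y r v′∈))
    ; path     = λ a∈ b∈ a≢b → ⊥-elim (a≢b (trans (x∈⁅y⁆⇒x≡y r a∈) (sym (x∈⁅y⁆⇒x≡y r b∈))))
    }

  module _ (acyclic : Acyclic D) {R d} (grown : Grown R d)
           {w u} (w∉R : w ∉ R) (u∈R : u ∈ R) (wu : Adj D w u) where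
    open Grown grown

    private
      R′ = R ∪ ⁅ w ⁆
      d′ = updateAt d w (λ _ → suc (d u))

      d′-w : d′ w ≡ suc (d u)
      d′-w = updateAt-updates w d

      d′-R : ∀ {v} → v ∈ R → d′ v ≡ d v
      d′-R {v} v∈R = updateAt-minimal v w d λ { refl → w∉R v∈R }

      only-neighbour : ∀ {v} → v ∈ R′ → Adj D w v → v ≡ u
      only-neighbour {v} v∈R′ wv with x∈p∪⁅y⁆⁻ v∈R′
      ... | inj₂ refl = ⊥-elim (Adj-irrefl wv refl)
      ... | inj₁ v∈R with v ≟ u
      ...   | yes v≡u = v≡u
      ...   | no  v≢u = ⊥-elim (acyclic (Path-close w∉R wv wu (path v∈R u∈R v≢u)))

      w-deeper : ∀ {a} → a ∈ R → Adj D a w → d′ a < d′ w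
      w-deeper a∈R aw with only-neighbour (p⊆p∪⁅y⁆ a∈R) (Adj-sym aw)
      ... | refl = subst₂ _<_ (sym (d′-R u∈R)) (sym d′-w) (n<1+n (d u))

      parent′ : AtMostOneParentOn R′ d′
      parent′ a∈ v∈ v′∈ av av′ v≤ v′≤ with x∈p∪⁅y⁆⁻ a∈ | x∈p∪⁅y⁆⁻ v∈ | x∈p∪⁅y⁆⁻ v′∈
      ... | inj₂ refl | _ | _ = trans (only-neighbour v∈ av) (sym (only-neighbour v′∈ av′))
      ... | inj₁ a∈R | inj₂ refl | _ = ⊥-elim (<⇒≱ (w-deeper a∈R av) v≤)
      ... | inj₁ a∈R | _ | inj₂ refl = ⊥-elim (<⇒≱ (w-deeper a∈R av′) v′≤)
      ... | inj₁ a∈R | inj₁ v∈R | inj₁ v′∈R = parent a∈R v∈R v′∈R av av′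
        (subst₂ _≤_ (d′-R v∈R) (d′-R a∈R) v≤) (subst₂ _≤_ (d′-R v′∈R) (d′-R a∈R) v′≤)

      path-from-w : ∀ {b} → b ∈ R → Path R′ w b
      path-from-w {b} b∈R with u ≟ b
      ... | yes refl = edge y∈p∪⁅y⁆ (p⊆p∪⁅y⁆ u∈R) wu
      ... | no  u≢b  = Path-∷ w∉R wu (path u∈R b∈R u≢b)

      path-to-w : ∀ {a} → a ∈ R → Path R′ a w
      path-to-w {a} a∈R with a ≟ u
      ... | yes refl = edge (p⊆p∪⁅y⁆ u∈R) y∈p∪⁅y⁆ (Adj-sym wu)
      ... | no  a≢u  = Path-∷ʳ w∉R (Adj-sym wu) (path a∈R u∈R a≢u)

      path′ : ∀ {a b} → a ∈ R′ → b ∈ R′ → a ≢ b → Path R′ a b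
      path′ a∈ b∈ a≢b with x∈p∪⁅y⁆⁻ a∈ | x∈p∪⁅y⁆⁻ b∈
      ... | inj₂ refl | inj₂ refl = ⊥-elim (a≢b refl)
      ... | inj₂ refl | inj₁ b∈R  = path-from-w b∈R
      ... | inj₁ a∈R  | inj₂ refl = path-to-w a∈R
      ... | inj₁ a∈R  | inj₁ b∈R  = Path-weaken p⊆p∪⁅y⁆ (path a∈R b∈R a≢b)

    Grown-extend : Grown (R ∪ ⁅ w ⁆) (updateAt d w (λ _ → suc (d u)))
    Grown-extend = record
      { nonempty = proj₁ nonempty , p⊆p∪⁅y⁆ (proj₂ nonempty)
      ; parent   = parent′
      ; path     = path′
      }

  Closed : Subset n → Set
  Closed R = ∀ {w u} → w ∉ R → u ∈ R → ¬ Adj D w u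

  Walk-closed : ∀ {R a b} → Closed R → Walk D a b → a ∈ R → b ∈ R
  Walk-closed closed here a∈R = a∈R
  Walk-closed {R} closed (step {v = v} av walk) a∈R with v ∈? R
  ... | yes v∈R = Walk-closed closed walk v∈R
  ... | no  v∉R = ⊥-elim (closed v∉R a∈R (Adj-sym av))

  module _ (arc? : ∀ u v → Dec (Arc u v)) where

    adj? : ∀ u v → Dec (Adj D u v)
    adj? u v = arc? u v ⊎-dec arc? v u

    InClosedOut? : ∀ v w → Dec (InClosedOut D v w)
    InClosedOut? v w = (w ≟ v) ⊎-dec arc? v w

    grow : Acyclic D → ∀ {R} → Acc _⊃_ R → ∀ {d} → Grown R d →
           ∃₂ λ R′ d′ → Grown R′ d′ × Closed R′
    grow acyclic {R} (acc rec) {d} grown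
      with any? (λ w → ¬? (w ∈? R) ×-dec any? (λ u → (u ∈? R) ×-dec adj? w u))
    ... | yes (w , w∉R , u , u∈R , wu) =
      grow acyclic (rec (p⊂p∪⁅x⁆ w∉R)) (Grown-extend acyclic grown w∉R u∈R wu)
    ... | no  no-exit = R , d , grown , λ w∉R u∈R wu → no-exit (_ , w∉R , _ , u∈R , wu)

    rootedAt : IsDitree D → Fin n → ∃ AtMostOneParent
    rootedAt (connected , acyclic) r with grow acyclic (⊃-wellFounded _) Grown-⁅ r ⁆
    ... | R , d , grown , closed = d , λ uv uv′ → parent (all _) (all _) (all _) uv uv′
      where
      open Grown grown
      all : ∀ v → v ∈ R
      all v = Walk-closed closed (connected (proj₁ nonempty) v) (proj₂ nonempty)

    module _ {d : Fin n → ℕ} (one-parent : AtMostOneParent d) where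

      Absorbs : Fin n → Fin n → Set
      Absorbs x t = InClosedOut D t x ×
        (∀ {y z} → d y ≤ d x → InClosedIn D x z → InClosedIn D y z → InClosedOut D t y)

      shallower-out-neighbours-≡ : ∀ {x y z} → Arc z x → Arc z y → d y ≤ d x → d x < d z → x ≡ y
      shallower-out-neighbours-≡ zx zy y≤x x<z =
        one-parent (inj₁ zx) (inj₁ zy) (<⇒≤ x<z) (≤-trans y≤x (<⇒≤ x<z))

      absorber : ∀ x → ∃ (Absorbs x)
      absorber x with any? (λ p → arc? p x ×-dec d p ≤? d x)
      ... | yes (p , px , p≤x) = p , inj₂ px , absorbs
        where
        absorbs : ∀ {y z} → d y ≤ d x → InClosedIn D x z → InClosedIn D y z → InClosedOut D p y
        absorbs y≤x (inj₁ refl) (inj₁ refl) = inj₂ px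
        absorbs y≤x (inj₂ yx)   (inj₁ refl) = inj₁ (one-parent (inj₂ yx) (inj₂ px) y≤x p≤x)
        absorbs y≤x (inj₁ refl) (inj₂ xy)   = inj₁ (one-parent (inj₁ xy) (inj₂ px) y≤x p≤x)
        absorbs y≤x (inj₂ zx)   (inj₂ zy) with d _ ≤? d x
        ... | yes z≤x = inj₂ (subst (λ a → Arc a _) (one-parent (inj₂ zx) (inj₂ px) z≤x p≤x) zy)
        ... | no  z≰x with shallower-out-neighbours-≡ zx zy y≤x (≰⇒> z≰x)
        ...   | refl = inj₂ px
      ... | no  no-parent = x , inj₁ refl , absorbs
        where
        absorbs : ∀ {y z} → d y ≤ d x → InClosedIn D x z → InClosedIn D y z → InClosedOut D x y
        absorbs y≤x (inj₁ refl) (inj₁ refl) = inj₁ refl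
        absorbs y≤x (inj₂ yx)   (inj₁ refl) = ⊥-elim (no-parent (_ , yx , y≤x))
        absorbs y≤x (inj₁ refl) (inj₂ xy)   = inj₂ xy
        absorbs y≤x (inj₂ zx)   (inj₂ zy) with d _ ≤? d x
        ... | yes z≤x = ⊥-elim (no-parent (_ , zx , z≤x))
        ... | no  z≰x with shallower-out-neighbours-≡ zx zy y≤x (≰⇒> z≰x)
        ...   | refl = inj₁ refl

      N⁺[_] : Fin n → Subset n
      N⁺[ t ] = select (InClosedOut? t)

      record GreedyState (F T M : Subset n) : Set where
        field
          dominated : ∀ {w} → w ∉ F → ∃ λ t → t ∈ T × InClosedOut D t w
          packing   : Packing D M
          separated : ∀ {x y} → x ∈ M → y ∈ F → ∀ z → ¬ (InClosedIn D x z × InClosedIn D y z)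
          ∣T∣≤∣M∣   : ∣ T ∣ ≤ ∣ M ∣

      GreedyState-start : GreedyState ⊤ ⊥ ⊥
      GreedyState-start = record
        { dominated = λ w∉⊤ → ⊥-elim (w∉⊤ ∈⊤)
        ; packing   = λ _ _ x∈⊥ → ⊥-elim (∉⊥ x∈⊥)
        ; separated = λ x∈⊥ → ⊥-elim (∉⊥ x∈⊥)
        ; ∣T∣≤∣M∣   = ≤-refl
        }

      GreedyState-step : ∀ {F T M x t} → GreedyState F T M →
                         x ∈ F → (∀ {y} → y ∈ F → d y ≤ d x) → Absorbs x t →
                         GreedyState (F ─ N⁺[ t ]) (T ∪ ⁅ t ⁆) (M ∪ ⁅ x ⁆)
      GreedyState-step {F} {T} {M} {x} {t} state x∈F x-deepest (_ , absorbs) = record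
        { dominated = dominated′
        ; packing   = packing′
        ; separated = separated′
        ; ∣T∣≤∣M∣   = size
        }
        where
        open GreedyState state
        open ≤-Reasoning

        x∉M : x ∉ M
        x∉M x∈M = separated x∈M x∈F x (inj₁ refl , inj₁ refl)

        dominated′ : ∀ {w} → w ∉ F ─ N⁺[ t ] → ∃ λ s → s ∈ T ∪ ⁅ t ⁆ × InClosedOut D s w
        dominated′ {w} w∉F′ with InClosedOut? t w
        ... | yes tw  = t , y∈p∪⁅y⁆ , tw
        ... | no  ¬tw
          with dominated (λ w∈F → w∉F′ (x∈p∧x∉q⇒x∈p─q w∈F (¬tw ∘ ∈-select⁻ (InClosedOut? t))))
        ...   | s , s∈T , sw = s , p⊆p∪⁅y⁆ s∈T , sw

        packing′ : Packing D (M ∪ ⁅ x ⁆)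
        packing′ a b a∈ b∈ a≢b z (az , bz) with x∈p∪⁅y⁆⁻ a∈ | x∈p∪⁅y⁆⁻ b∈
        ... | inj₁ a∈M | inj₁ b∈M = packing a b a∈M b∈M a≢b z (az , bz)
        ... | inj₁ a∈M | inj₂ refl = separated a∈M x∈F z (az , bz)
        ... | inj₂ refl | inj₁ b∈M = separated b∈M x∈F z (bz , az)
        ... | inj₂ refl | inj₂ refl = a≢b refl

        separated′ : ∀ {a y} → a ∈ M ∪ ⁅ x ⁆ → y ∈ F ─ N⁺[ t ] →
                     ∀ z → ¬ (InClosedIn D a z × InClosedIn D y z)
        separated′ a∈ y∈F′ z (az , yz) with x∈p∪⁅y⁆⁻ a∈
        ... | inj₁ a∈M  = separated a∈M (p─q⊆p F _ y∈F′) z (az , yz)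
        ... | inj₂ refl = x∈p─q⇒x∉q y∈F′
          (∈-select⁺ (InClosedOut? t) (absorbs (x-deepest (p─q⊆p F _ y∈F′)) az yz))

        size : ∣ T ∪ ⁅ t ⁆ ∣ ≤ ∣ M ∪ ⁅ x ⁆ ∣
        size = begin
          ∣ T ∪ ⁅ t ⁆ ∣ ≤⟨ ∣p∪⁅x⁆∣≤1+∣p∣ T t ⟩
          suc ∣ T ∣     ≤⟨ s≤s ∣T∣≤∣M∣ ⟩
          suc ∣ M ∣     ≤⟨ p⊂q⇒∣p∣<∣q∣ (p⊂p∪⁅x⁆ x∉M) ⟩
          ∣ M ∪ ⁅ x ⁆ ∣ ∎

      greedy : ∀ {F T M} → Acc _⊂_ F → GreedyState F T M →
               ∃₂ λ T M → Dominating D T × Packing D M × ∣ T ∣ ≤ ∣ M ∣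
      greedy {F} {T} {M} (acc rec) state with nonempty? F
      ... | no  F-empty = T , M , (λ w → dominated λ w∈F → F-empty (w , w∈F)) , packing , ∣T∣≤∣M∣
        where open GreedyState state
      ... | yes F-nonempty with deepest d F-nonempty
      ...   | x , x∈F , x-deepest with absorber x
      ...     | t , absorbs =
        greedy (rec (p∩q≢∅⇒p─q⊂p F N⁺[ t ] (x , x∈p∩q⁺ (x∈F , x∈N⁺[t]))))
               (GreedyState-step state x∈F x-deepest absorbs)
        where
        x∈N⁺[t] : x ∈ N⁺[ t ]
        x∈N⁺[t] = ∈-select⁺ (InClosedOut? t) (proj₁ absorbs)

      dominating-packing-pair : ∃₂ λ T M → Dominating D T × Packing D M × ∣ T ∣ ≤ ∣ M ∣
      dominating-packing-pair = greedy (⊂-wellFounded ⊤) GreedyState-start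

rooting : ∀ {n} (D : Digraph n) → (∀ u v → Dec (Digraph.Arc D u v)) → IsDitree D →
          ∃ (AtMostOneParent D)
rooting {zero}  D _    _     = (λ ()) , λ {u} → ⊥-elim (¬Fin0 u)
rooting {suc n} D arc? ditree = rootedAt D arc? ditree zero

theorem1p2 : ∀ (n : ℕ) (T : Digraph n) → IsDitree T →
    ∀ (p g : ℕ) → IsPackingNumber T p → IsDominationNumber T g → p ≡ g
theorem1p2 n T ditree p g ((P , P-packing , ∣P∣≡p) , p-max) ((S , S-dominating , ∣S∣≡g) , g-min) =
  -- Arcs need not be decidable, but g ≤ p is, so we may argue under a double negation.
  ≤-antisym p≤g (decidable-stable (g ≤? p) (¬¬-map g≤p arcs-decidable))
  where
  p≤g : p ≤ g
  p≤g = subst₂ _≤_ ∣P∣≡p ∣S∣≡g (∣packing∣≤∣dominating∣ T P-packing S-dominating)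

  arcs-decidable : ¬ ¬ (∀ u v → Dec (Digraph.Arc T u v))
  arcs-decidable = ¬¬-∀-Fin λ u → ¬¬-∀-Fin λ v → ¬¬-excluded-middle

  g≤p : (∀ u v → Dec (Digraph.Arc T u v)) → g ≤ p
  g≤p arc? with dominating-packing-pair T arc? (proj₂ (rooting T arc? ditree))
  ... | S′ , P′ , S′-dominating , P′-packing , ∣S′∣≤∣P′∣ =
    ≤-trans (g-min S′ S′-dominating) (≤-trans ∣S′∣≤∣P′∣ (p-max P′ P′-packing))
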